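{- For $k\in\{2,3\}$: for every algorithm $\mathcal{A}$ (in the exploration model described in the context) that successfully explores all connected graphs with exactly $k$ vertices, there is a connected graph $G$ with $k$ vertices such that $\mathcal{A}$ uses at least $k-1$ colors to explore $G$.
   Context: Exploration model. Graphs are finite, simple, undirected and connected; vertices are anonymous and edges carry no port labels. Each vertex carries a color in $\mathbb{N}=\{0,1,2,\dots\}$, where $0$ means "uncolored"; initially all vertices have color $0$. An algorithm is a function $\mathrm{move}$ mapping every environment $(c_0,E)$ — where $c_0\in\mathbb{N}$ is the color of the agent's current vertex and $E:\mathbb{N}\to\mathbb{N}$ (zero almost everywhere) gives, for each color $c$, the number $E(c)$ of neighbors of the current vertex having color $c$ — either to $\mathrm{Stop}$ or to a pair $(c_1,d)\in\mathbb{N}\times\mathbb{N}$ with $E(d)>0$, subject to $c_1=c_0$ whenever $c_0\neq 0$ (a vertex may only be colored while it is uncolored). A run on a graph $G$: an adversary chooses a start vertex $v_0$ and places the agent there; in each step, with the agent at $v$, $\mathrm{move}$ is evaluated at the environment of $v$; if the value is $\mathrm{Stop}$ the run ends, and if it is $(c_1,d)$ then $v$ receives color $c_1$ and the adversary chooses an arbitrary neighbor of $v$ of color $d$, to which the agent moves. The agent has no other memory. A vertex is visited if the agent is located at it in some step. An algorithm successfully explores $G$ if for every adversary (every choice of start vertex and of neighbors), after finitely many steps all vertices have been visited, the agent is at $v_0$, and the decision is $\mathrm{Stop}$. The number of colors used in a run is the number of distinct nonzero colors assigned during the run; $\mathcal{A}$ uses at least $m$ colors to explore $G$ if some run of $\mathcal{A}$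 on $G$ (for some adversary) uses at least $m$ colors. -}

module Defs where

open import Data.Nat using (ℕ; zero; suc; _+_; _≤_; _<_; _≡ᵇ_)
open import Data.Bool using (Bool; true; false; _∧_; if_then_else_)
open import Data.Fin using (Fin)
open import Data.List using (List; foldr; allFin)
open import Data.Product using (Σ; ∃; ∃-syntax; _×_; _,_)
open import Relation.Binary.PropositionalEquality using (_≡_; _≢_)
open import Function.Definitions using (Injective)

data Reach {n : ℕ} (adj : Fin n → Fin n → Bool) : Fin n → Fin n → Set where
  here  : ∀ {u} → Reach adj u u
  there : ∀ {u w v} → adj u w ≡ true → Reach adj w v → Reach adj u v

record Graph (n : ℕ) : Set where
  field
    adj       : Fin n → Fin n → Bool
    symmetric : ∀ u v → adj u v ≡ adj v u
    irreflex  : ∀ u → adj u u ≡ false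
    connected : ∀ u v → Reach adj u v
open Graph public

FinSupp : (ℕ → ℕ) → Set
FinSupp E = ∃[ b ] (∀ c → b ≤ c → E c ≡ 0)

data Decision : Set where
  stop : Decision
  go   : (c₁ d : ℕ) → Decision

-- An algorithm is a function on environments (c₀ , E) with E finitely
-- supported; the finiteness proof is irrelevant, so move cannot depend on it.
record Algorithm : Set where
  field
    move  : (c₀ : ℕ) (E : ℕ → ℕ) → .(FinSupp E) → Decision
    valid : ∀ c₀ E .(fs : FinSupp E) c₁ d → move c₀ E fs ≡ go c₁ d →
            (0 < E d) × (c₀ ≢ 0 → c₁ ≡ c₀)
open Algorithm public

record Config (n : ℕ) : Set where
  constructor ⟨_,_⟩
  field
    col : Fin n → ℕ      -- current coloring (0 = uncolored)
    pos : Fin n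
open Config public

nbrCount : ∀ {n} → Graph n → (Fin n → ℕ) → Fin n → ℕ → ℕ
nbrCount G col v c =
  foldr (λ w acc → (if adj G v w ∧ (col w ≡ᵇ c) then 1 else 0) + acc) 0 (allFin _)

envE : ∀ {n} → Graph n → Config n → ℕ → ℕ
envE G s = nbrCount G (col s) (pos s)

decide : ∀ {n} → Algorithm → (G : Graph n) → (s : Config n) → .(FinSupp (envE G s)) → Decision
decide A G s fs = move A (col s (pos s)) (envE G s) fs

data Step {n : ℕ} (A : Algorithm) (G : Graph n) (s s' : Config n) : Set where
  halt : (fs : FinSupp (envE G s)) → decide A G s fs ≡ stop →
         pos s' ≡ pos s → (∀ w → col s' w ≡ col s w) → Step A G s s'
  walk : (fs : FinSupp (envE G s)) (c₁ d : ℕ) → decide A G s fs ≡ go c₁ d →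
         adj G (pos s) (pos s') ≡ true →
         col s (pos s') ≡ d →
         col s' (pos s) ≡ c₁ →
         (∀ w → w ≢ pos s → col s' w ≡ col s w) →
         Step A G s s'

-- A run: the adversary picks the start vertex v₀ and every move; cfg t is
-- the configuration after t steps (constant after the algorithm stops).
record Run {n : ℕ} (A : Algorithm) (G : Graph n) : Set where
  field
    v₀       : Fin n
    cfg      : ℕ → Config n
    startPos : pos (cfg 0) ≡ v₀
    startCol : ∀ w → col (cfg 0) w ≡ 0
    steps    : ∀ t → Step A G (cfg t) (cfg (suc t))
open Run public

Explores : ∀ {n} → Algorithm → Graph n → Set
Explores A G =
  (r : Run A G) → ∃[ t ]
    ( (Σ (FinSupp (envE G (cfg r t))) λ fs → decide A G (cfg r t) fs ≡ stop)
    × pos (cfg r t) ≡ v₀ r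
    × (∀ w → ∃[ s ] (s ≤ t × pos (cfg r s) ≡ w)) )

UsesAtLeast : ∀ {n} → Algorithm → Graph n → ℕ → Set
UsesAtLeast A G m =
  Σ (Run A G) λ r →
  Σ (Fin m → ℕ) λ f →
    Injective _≡_ _≡_ f ×
    (∀ i → f i ≢ 0 × ∃[ t ] ∃[ w ] (col (cfg r t) w ≡ f i))

-- On two vertices the first move must paint a nonzero colour: otherwise the adversary shuttles
-- the agent along the edge forever. On three vertices suppose one colour a suffices. On the path
-- P₃ started at its centre, every branch that neither paints a second colour nor lets the
-- adversary trap the agent forces the walk 1 → 0 → 1 → 2 → 1, painting every vertex a and
-- stopping at vertex 1. The environments of these forced decisions recur in the triangle K₃
-- started at vertex 0, where they let the adversary steer the agent to vertex 1 of the fully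
-- painted triangle, where it stops away from its start, or keep it cycling. Each
-- contradiction is an adversary confining the agent to a finite lasso of states that misses a
-- vertex or never halts at the start.
{-# OPTIONS --safe #-}
module Submission where

open import Defs
open import Data.Nat using (ℕ; zero; suc; _+_; _∸_; _<_; _⊔_; _≡ᵇ_)
import Data.Nat.Properties as ℕ
open import Data.Nat.Properties using (m≤m⊔n; m≤n⊔m; ≤-trans; <⇒≢; ≡ᵇ⇒≡)
open import Data.Bool using (Bool; true; false; _∧_; not; _xor_; if_then_else_; T)
open import Data.Bool.Properties using (∧-zeroʳ; xor-comm; xor-same)
open import Data.Fin using (Fin; zero; suc; _≟_)
open import Data.List using (List; []; _∷_; foldr; allFin)
open import Data.List.Membership.Propositional using (_∈_; find)
open import Data.List.Relation.Unary.All using (All; []; _∷_)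
import Data.List.Relation.Unary.All as All
open import Data.List.Relation.Unary.Any using (Any; here; there)
open import Data.Product using (Σ; ∃; _×_; _,_; proj₁; proj₂)
open import Data.Empty using (⊥; ⊥-elim)
open import Data.Sum using (_⊎_; inj₁; inj₂)
import Data.Sum as Sum
open import Data.Unit using (⊤; tt)
open import Data.Vec using (Vec; []; _∷_; lookup; replicate; _[_]≔_)
open import Data.Vec.Properties using (lookup∘update; lookup∘update′; lookup-replicate)
open import Function using (_∘_)
open import Function.Definitions using (Injective)
open import Relation.Binary.Construct.Closure.ReflexiveTransitive using (Star; ε; _◅_; _◅◅_)
open import Relation.Nullary using (¬_; yes; no; does)
open import Relation.Nullary.Decidable using (dec-true; dec-false)
open import Relation.Binary.PropositionalEquality

does-≟-sym : ∀ {n} (u v : Fin n) → does (u ≟ v) ≡ does (v ≟ u)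
does-≟-sym u v with u ≟ v
... | yes u≡v = sym (dec-true (v ≟ u) (sym u≡v))
... | no u≢v  = sym (dec-false (v ≟ u) (λ v≡u → u≢v (sym v≡u)))

complete : ∀ n → Graph n
complete n = record
  { adj       = λ u v → not (does (u ≟ v))
  ; symmetric = λ u v → cong not (does-≟-sym u v)
  ; irreflex  = λ u → cong not (dec-true (u ≟ u) refl)
  ; connected = reach
  }
  where
  reach : ∀ u v → Reach (λ u v → not (does (u ≟ v))) u v
  reach u v with u ≟ v in eq
  ... | yes refl = here
  ... | no _     = there (cong not (cong does eq)) here

star : ∀ {n} → Fin n → Graph n
star {n} centre = record
  { adj       = edge
  ; symmetric = λ u v → xor-comm (does (u ≟ centre)) (does (v ≟ centre))
  ; irreflex  = λ u → xor-same (does (u ≟ centre))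
  ; connected = reach
  }
  where
  edge : Fin n → Fin n → Bool
  edge u v = does (u ≟ centre) xor does (v ≟ centre)

  inward : ∀ {u} → u ≢ centre → edge u centre ≡ true
  inward {u} u≢c rewrite dec-false (u ≟ centre) u≢c | dec-true (centre ≟ centre) refl = refl

  outward : ∀ {v} → v ≢ centre → edge centre v ≡ true
  outward {v} v≢c = trans (xor-comm (does (centre ≟ centre)) (does (v ≟ centre))) (inward v≢c)

  reach : ∀ u v → Reach edge u v
  reach u v with u ≟ centre | v ≟ centre
  ... | yes refl | yes refl = here
  ... | yes refl | no v≢c   = there (outward v≢c) here
  ... | no u≢c   | yes refl = there (inward u≢c) here
  ... | no u≢c   | no v≢c   = there {w = centre} (inward u≢c) (there (outward v≢c) here)

≡ᵇ-false : ∀ {m n} → m ≢ n → (m ≡ᵇ n) ≡ false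
≡ᵇ-false {m} {n} = dec-false (m ℕ.≟ n)

module _ {n} (G : Graph n) (col : Fin n → ℕ) (v : Fin n) where

  private
    count : List (Fin n) → ℕ → ℕ
    count l c = foldr (λ w acc → (if adj G v w ∧ (col w ≡ᵇ c) then 1 else 0) + acc) 0 l

    bounded : ∀ l → FinSupp (count l)
    bounded []      = 0 , λ _ _ → refl
    bounded (w ∷ l) with bounded l
    ... | b , vanish = suc (col w) ⊔ b , λ c bound≤c →
      cong₂ _+_ (absent c (≤-trans (m≤m⊔n (suc (col w)) b) bound≤c))
                (vanish c (≤-trans (m≤n⊔m (suc (col w)) b) bound≤c))
      where
      absent : ∀ c → col w < c → (if adj G v w ∧ (col w ≡ᵇ c) then 1 else 0) ≡ 0
      absent c w<c rewrite ≡ᵇ-false (<⇒≢ w<c) | ∧-zeroʳ (adj G v w) = refl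

    witness : ∀ l d → 0 < count l d → ∃ λ w → adj G v w ≡ true × col w ≡ d
    witness (w ∷ l) d positive with adj G v w in vw | col w ≡ᵇ d in wd
    ... | true  | true  = w , vw , ≡ᵇ⇒≡ (col w) d (subst T (sym wd) tt)
    ... | true  | false = witness l d positive
    ... | false | _     = witness l d positive

  nbrCount-finSupp : FinSupp (nbrCount G col v)
  nbrCount-finSupp = bounded (allFin n)

  nbrCount-witness : ∀ d → 0 < nbrCount G col v d → ∃ λ w → adj G v w ≡ true × col w ≡ d
  nbrCount-witness = witness (allFin n)

infix 4 _∣_

-- Colourings are vectors, so along a concrete run they normalise to literal vectors and states
-- reached along different paths are definitionally equal.
record State (n : ℕ) : Set where
  constructor _∣_
  field
    colours : Vec ℕ n
    agent   : Fin n
open State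

config : ∀ {n} → State n → Config n
config (v ∣ p) = ⟨ lookup v , p ⟩

blank : ∀ {n} → Fin n → State n
blank {n} p = replicate n 0 ∣ p

module Exploration (A : Algorithm) {n : ℕ} (G : Graph n) where

  finSupp : ∀ σ → FinSupp (envE G (config σ))
  finSupp (v ∣ p) = nbrCount-finSupp G (lookup v) p

  -- The FinSupp argument of decide is irrelevant, so dec σ is decide at any such proof.
  dec : State n → Decision
  dec σ = decide A G (config σ) (finSupp σ)

  -- Halts and _⟶_ are a record and a data type rather than definitions, so that their state
  -- arguments are recovered by unification (config is not injective up to conversion).
  record Halts (σ : State n) : Set where
    constructor halting
    field stops-here : dec σ ≡ stop

  moving : ∀ {σ c d} → dec σ ≡ go c d → ¬ Halts σ
  moving moves (halting halts) with trans (sym moves) halts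
  ... | ()

  infix 4 _⟶_ _⟶*_

  data _⟶_ : State n → State n → Set where
    advance : ∀ {v p c d} → dec (v ∣ p) ≡ go c d → ∀ w → adj G p w ≡ true → lookup v w ≡ d →
              (v ∣ p) ⟶ (v [ p ]≔ c ∣ w)

  _⟶*_ : State n → State n → Set
  _⟶*_ = Star _⟶_

  ⟶-moving : ∀ {σ σ'} → σ ⟶ σ' → ¬ Halts σ
  ⟶-moving (advance {v} {p} moves _ _ _) = moving {v ∣ p} moves

  ⟶-step : ∀ {σ σ'} → σ ⟶ σ' → Step A G (config σ) (config σ')
  ⟶-step (advance {v} {p} {c} moves w pw colour) =
    walk (finSupp (v ∣ p)) _ _ moves pw colour (lookup∘update p v c) (λ u u≢p → lookup∘update′ u≢p v c)

  stutter : ∀ {σ} → dec σ ≡ stop → Step A G (config σ) (config σ)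
  stutter {σ} halts = halt (finSupp σ) halts refl (λ _ → refl)

  data Choice (σ : State n) : Set where
    stops : dec σ ≡ stop → Choice σ
    goes  : ∀ c w → adj G (agent σ) w ≡ true → dec σ ≡ go c (lookup (colours σ) w) → Choice σ

  choice : ∀ σ → Choice σ
  choice σ@(v ∣ p) with dec σ in moves
  ... | stop   = stops moves
  ... | go c d with nbrCount-witness G (lookup v) p d (proj₁ (valid A _ _ _ c d moves))
  ...   | w , pw , refl = goes c w pw moves

  data ColouredChoice (σ : State n) : Set where
    stops : dec σ ≡ stop → ColouredChoice σ
    goes  : ∀ w → adj G (agent σ) w ≡ true →
            dec σ ≡ go (lookup (colours σ) (agent σ)) (lookup (colours σ) w) → ColouredChoice σ

  colouredChoice : ∀ σ → lookup (colours σ) (agent σ) ≢ 0 → ColouredChoice σ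
  colouredChoice σ coloured with choice σ
  ... | stops halts = stops halts
  ... | goes c w pw moves with proj₂ (valid A _ _ _ _ _ moves) coloured
  ...   | refl = goes w pw moves

  record Walk (σ : State n) : Set where
    field
      stateAt : ℕ → State n
      start   : stateAt 0 ≡ σ
      steps   : ∀ t → Step A G (config (stateAt t)) (config (stateAt (suc t)))
  open Walk

  Closed : (State n → Set) → Set
  Closed P = ∀ σ → P σ → ∃ λ σ' → Step A G (config σ) (config σ') × P σ'

  confine : ∀ {P σ} → Closed P → P σ → Σ (Walk σ) λ w → ∀ t → P (stateAt w t)
  confine {P} {σ} closed inP = walk′ , proj₂ ∘ trace
    where
    trace : ℕ → Σ (State n) P
    trace zero    = σ , inP
    trace (suc t) = let _ , _ , inP′ = closed _ (proj₂ (trace t)) in _ , inP′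

    walk′ : Walk σ
    walk′ = record
      { stateAt = proj₁ ∘ trace
      ; start   = refl
      ; steps   = λ t → proj₁ (proj₂ (closed _ (proj₂ (trace t))))
      }

  successor : ∀ σ → ∃ λ σ' → Step A G (config σ) (config σ')
  successor σ@(v ∣ p) with choice σ
  ... | stops halts       = σ , stutter {σ} halts
  ... | goes c w pw moves = (v [ p ]≔ c ∣ w) , ⟶-step (advance {v} {p} moves w pw refl)

  anyWalk : ∀ σ → Walk σ
  anyWalk σ = proj₁ (confine {P = λ _ → ⊤} {σ} extend tt)
    where
    extend : Closed (λ _ → ⊤)
    extend τ _ = proj₁ (successor τ) , proj₂ (successor τ) , tt

  cons : ∀ {σ σ'} → Step A G (config σ) (config σ') → Walk σ' → Walk σ
  cons {σ} st w = record
    { stateAt = λ { zero → σ ; (suc t) → stateAt w t }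
    ; start   = refl
    ; steps   = λ { zero → subst (λ x → Step A G (config σ) (config x)) (sym (start w)) st
                  ; (suc t) → steps w t }
    }

  prepend : ∀ {σ σ'} → σ ⟶* σ' → Walk σ' → Walk σ
  prepend ε        w = w
  prepend (st ◅ p) w = cons (⟶-step st) (prepend p w)

  sources : ∀ {σ σ'} → σ ⟶* σ' → List (State n)
  sources ε             = []
  sources (_◅_ {σ} _ p) = σ ∷ sources p

  sources-moving : ∀ {σ σ'} (p : σ ⟶* σ') → All (¬_ ∘ Halts) (sources p)
  sources-moving ε        = []
  sources-moving (st ◅ p) = ⟶-moving st ∷ sources-moving p

  prepend-reaches : ∀ {σ σ'} (p : σ ⟶* σ') (w : Walk σ') → ∃ λ t → stateAt (prepend p w) t ≡ σ'
  prepend-reaches ε       w = 0 , start w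
  prepend-reaches (_ ◅ p) w = let t , reached = prepend-reaches p w in suc t , reached

  prepend-located : ∀ {σ σ'} (p : σ ⟶* σ') (w : Walk σ') t →
                    stateAt (prepend p w) t ∈ sources p ⊎
                    ∃ λ t′ → stateAt (prepend p w) t ≡ stateAt w t′
  prepend-located ε       w t       = inj₂ (t , refl)
  prepend-located (_ ◅ p) w zero    = inj₁ (here refl)
  prepend-located (_ ◅ p) w (suc t) = Sum.map₁ there (prepend-located p w t)

  walkRun : ∀ {p} → Walk (blank p) → Run A G
  walkRun {p} w = record
    { v₀       = p
    ; cfg      = config ∘ stateAt w
    ; startPos = cong agent (start w)
    ; startCol = λ u → trans (cong (λ σ → lookup (colours σ) u) (start w)) (lookup-replicate u 0)
    ; steps    = steps w
    }

  reachable-uses : ∀ {p σ m} → blank p ⟶* σ → (f : Fin m → ℕ) → Injective _≡_ _≡_ f →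
                   (∀ i → f i ≢ 0) → (∀ i → ∃ λ w → lookup (colours σ) w ≡ f i) →
                   UsesAtLeast A G m
  reachable-uses {σ = σ} p f injective nonzero shown with prepend-reaches p (anyWalk σ)
  ... | t , reached =
    walkRun (prepend p (anyWalk σ)) , f , injective ,
    λ i → nonzero i , t , proj₁ (shown i) ,
          trans (cong (λ τ → lookup (colours τ) (proj₁ (shown i))) reached) (proj₂ (shown i))

  data Trapped (L : List (State n)) (σ : State n) : Set where
    halted : dec σ ≡ stop → Trapped L σ
    moved  : Any (σ ⟶_) L → Trapped L σ

  trapped-closed : ∀ {L} → All (Trapped L) L → Closed (_∈ L)
  trapped-closed trap σ σ∈L with All.lookup trap σ∈L
  ... | halted halts = σ , stutter {σ} halts , σ∈L
  ... | moved next with find next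
  ...   | σ' , σ'∈L , st = σ' , ⟶-step st , σ'∈L

  -- The adversary follows prefix and then keeps the agent inside σ ∷ L; as an exploration,
  -- this run has to visit every vertex and halt at its start.
  module Traps (explores : Explores A G) {p σ} (prefix : blank p ⟶* σ)
           {L} (trap : All (Trapped (σ ∷ L)) (σ ∷ L)) where

    private
      confined : Σ (Walk σ) λ w → ∀ t → stateAt w t ∈ σ ∷ L
      confined = confine (trapped-closed trap) (here refl)

      run : Run A G
      run = walkRun (prepend prefix (proj₁ confined))

      located : ∀ t → stateAt (prepend prefix (proj₁ confined)) t ∈ sources prefix ⊎
                      stateAt (prepend prefix (proj₁ confined)) t ∈ σ ∷ L
      located t = Sum.map₂ (λ { (t′ , eq) → subst (_∈ σ ∷ L) (sym eq) (proj₂ confined t′) })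
                           (prepend-located prefix (proj₁ confined) t)

    no-avoiding-trap : ∀ w → All (λ τ → agent τ ≢ w) (sources prefix) →
                       All (λ τ → agent τ ≢ w) (σ ∷ L) → ⊥
    no-avoiding-trap w avoidsPrefix avoidsTrap with explores run
    ... | _ , _ , _ , visited with visited w
    ...   | t , _ , atW with located t
    ...     | inj₁ inPrefix = All.lookup avoidsPrefix inPrefix atW
    ...     | inj₂ inTrap   = All.lookup avoidsTrap inTrap atW

    no-nonhalting-trap : All (λ τ → agent τ ≡ p → ¬ Halts τ) (σ ∷ L) → ⊥
    no-nonhalting-trap idle with explores run
    ... | t , (_ , halts) , atStart , _ with located t
    ...   | inj₁ inPrefix = All.lookup (sources-moving prefix) inPrefix (halting halts)
    ...   | inj₂ inTrap   = All.lookup idle inTrap atStart (halting halts)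

pattern #0 = zero
pattern #1 = suc zero
pattern #2 = suc (suc zero)

⟦_,_,_∣_⟧ : ℕ → ℕ → ℕ → Fin 3 → State 3
⟦ x , y , z ∣ p ⟧ = x ∷ y ∷ z ∷ [] ∣ p

data Comparison (a : ℕ) : ℕ → Set where
  none  : Comparison a 0
  again : Comparison a a
  other : ∀ {c} → c ≢ 0 → c ≢ a → Comparison a c

compare : ∀ a c → Comparison a c
compare a c with c ℕ.≟ 0 | c ℕ.≟ a
... | yes refl | _        = none
... | no _     | yes refl = again
... | no c≢0   | no c≢a   = other c≢0 c≢a

pair-injective : ∀ {a c : ℕ} → c ≢ a → Injective _≡_ _≡_ (lookup (a ∷ c ∷ []))
pair-injective c≢a {#0} {#0} _   = refl
pair-injective c≢a {#0} {#1} a≡c = ⊥-elim (c≢a (sym a≡c))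
pair-injective c≢a {#1} {#0} c≡a = ⊥-elim (c≢a c≡a)
pair-injective c≢a {#1} {#1} _   = refl

module TwoVertices (A : Algorithm) (explores : (G : Graph 2) → Explores A G) where

  K₂ : Graph 2
  K₂ = complete 2

  module K = Exploration A K₂
  open Exploration using (stops; goes; advance; halted; moved)

  one-colour-needed : Σ (Graph 2) λ G → UsesAtLeast A G 1
  one-colour-needed with K.choice (blank #0)
  ... | stops halts = ⊥-elim (K.Traps.no-avoiding-trap (explores K₂) {p = #0} ε (halted halts ∷ []) #1
                                [] ((λ ()) ∷ []))
  ... | goes c #1 _ first with c ℕ.≟ 0
  ...   | yes refl = ⊥-elim (K.Traps.no-nonhalting-trap (explores K₂) {p = #0} ε
            (moved (there (here (advance first #1 refl refl))) ∷ moved (here (advance first #0 refl refl)) ∷ [])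
            ((λ _ → K.moving first) ∷ (λ ()) ∷ []))
  ...   | no c≢0 = K₂ , K.reachable-uses {p = #0} (advance first #1 refl refl ◅ ε) (λ _ → c)
                          (λ { {#0} {#0} _ → refl }) (λ _ → c≢0) (λ _ → #0 , refl)

module ThreeVertices (A : Algorithm) (explores : (G : Graph 3) → Explores A G) where

  K₃ P₃ : Graph 3
  K₃ = complete 3
  P₃ = star #1

  module K = Exploration A K₃
  module P = Exploration A P₃
  open Exploration using (stops; goes; advance; halted; moved)

  TwoColours : Set
  TwoColours = Σ (Graph 3) λ G → UsesAtLeast A G 2

  twoColours : ∀ G {p σ a c} → Exploration._⟶*_ A G (blank p) σ → a ≢ 0 → c ≢ 0 → c ≢ a →
               ∃ (λ w → lookup (colours σ) w ≡ a) → ∃ (λ w → lookup (colours σ) w ≡ c) →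
               TwoColours
  twoColours G p a≢0 c≢0 c≢a showsA showsC =
    G , Exploration.reachable-uses A G p (lookup (_ ∷ _ ∷ [])) (pair-injective c≢a)
          (λ { #0 → a≢0 ; #1 → c≢0 }) (λ { #0 → showsA ; #1 → showsC })

  -- first, turn and done are decisions at environments occurring in both K₃ and P₃ (an
  -- uncoloured vertex with two uncoloured neighbours; a vertex coloured a with neighbours
  -- coloured a and 0; a vertex coloured a with two neighbours coloured a), so each is used in
  -- both graphs.
  module _ {a} (a≢0 : a ≢ 0) (first : K.dec ⟦ 0 , 0 , 0 ∣ #0 ⟧ ≡ go a 0) where

    module Triangle (turn : P.dec ⟦ a , a , 0 ∣ #1 ⟧ ≡ go a 0)
                    (done : P.dec ⟦ a , a , a ∣ #1 ⟧ ≡ stop) where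

      open K.Traps (explores K₃)

      step₁ : blank #0 K.⟶ ⟦ a , 0 , 0 ∣ #1 ⟧
      step₁ = advance first #1 refl refl

      apex : ∀ {c} → blank #0 K.⟶* ⟦ a , a , 0 ∣ #2 ⟧ → K.dec ⟦ a , a , 0 ∣ #2 ⟧ ≡ go c a →
             TwoColours
      apex {c} p moves with compare a c
      ... | none = ⊥-elim (no-nonhalting-trap p
              (moved (there (here (advance moves #1 refl refl))) ∷ moved (here (advance turn #2 refl refl)) ∷ [])
              ((λ _ → K.moving moves) ∷ (λ _ → K.moving turn) ∷ []))
      ... | again = ⊥-elim (no-nonhalting-trap p
              (moved (there (here (advance moves #1 refl refl))) ∷ halted done ∷ [])
              ((λ _ → K.moving moves) ∷ (λ ()) ∷ []))
      ... | other c≢0 c≢a =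
              twoColours K₃ (p ◅◅ advance moves #1 refl refl ◅ ε) a≢0 c≢0 c≢a (#0 , refl) (#2 , refl)

      atApex : blank #0 K.⟶* ⟦ a , a , 0 ∣ #2 ⟧ → TwoColours
      atApex p with K.choice ⟦ a , a , 0 ∣ #2 ⟧
      ... | stops halts       = ⊥-elim (no-nonhalting-trap p (halted halts ∷ []) ((λ ()) ∷ []))
      ... | goes c #0 _ moves = apex p moves
      ... | goes c #1 _ moves = apex p moves
      ... | goes c #2 () _

      shuttle : K.dec ⟦ a , 0 , 0 ∣ #1 ⟧ ≡ go 0 a → K.dec ⟦ a , 0 , 0 ∣ #0 ⟧ ≡ go a 0 → ⊥
      shuttle moves back = no-avoiding-trap (step₁ ◅ ε)
        (moved (there (here (advance moves #0 refl refl))) ∷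
               moved (here (advance back #1 refl refl)) ∷ []) #2
        ((λ ()) ∷ []) ((λ ()) ∷ (λ ()) ∷ [])

      backToStart : K.dec ⟦ a , 0 , 0 ∣ #1 ⟧ ≡ go 0 a → TwoColours
      backToStart moves with K.colouredChoice ⟦ a , 0 , 0 ∣ #0 ⟧ a≢0
      ... | stops halts = ⊥-elim (no-avoiding-trap (step₁ ◅ advance moves #0 refl refl ◅ ε)
              (halted halts ∷ []) #2 ((λ ()) ∷ (λ ()) ∷ []) ((λ ()) ∷ []))
      ... | goes #1 _ back = ⊥-elim (shuttle moves back)
      ... | goes #2 _ back = ⊥-elim (shuttle moves back)

      afterFirstStep : TwoColours
      afterFirstStep with K.choice ⟦ a , 0 , 0 ∣ #1 ⟧
      ... | stops halts =
              ⊥-elim (no-avoiding-trap (step₁ ◅ ε) (halted halts ∷ []) #2 ((λ ()) ∷ []) ((λ ()) ∷ []))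
      ... | goes c #0 _ moves with compare a c
      ...   | none          = backToStart moves
      ...   | again         = atApex (step₁ ◅ advance moves #0 refl refl ◅ advance turn #2 refl refl ◅ ε)
      ...   | other c≢0 c≢a =
                twoColours K₃ (step₁ ◅ advance moves #0 refl refl ◅ ε) a≢0 c≢0 c≢a (#0 , refl) (#1 , refl)
      afterFirstStep | goes c #2 _ moves with compare a c
      ...   | none          = ⊥-elim (no-nonhalting-trap (step₁ ◅ ε)
                                (moved (there (here (advance moves #2 refl refl))) ∷
                                 moved (here (advance moves #1 refl refl)) ∷ [])
                                ((λ ()) ∷ (λ ()) ∷ []))
      ...   | again         = atApex (step₁ ◅ advance moves #2 refl refl ◅ ε)
      ...   | other c≢0 c≢a =
                twoColours K₃ (step₁ ◅ advance moves #2 refl refl ◅ ε) a≢0 c≢0 c≢a (#0 , refl) (#1 , refl)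

    module Path where

      open P.Traps (explores P₃)

      step₁ : blank #1 P.⟶ ⟦ 0 , a , 0 ∣ #0 ⟧
      step₁ = advance first #0 refl refl

      shuttle : P.dec ⟦ 0 , a , 0 ∣ #0 ⟧ ≡ go 0 a → P.dec ⟦ 0 , a , 0 ∣ #1 ⟧ ≡ go a 0 → ⊥
      shuttle moves back = no-avoiding-trap (step₁ ◅ ε)
        (moved (there (here (advance moves #1 refl refl))) ∷
         moved (here (advance back #0 refl refl)) ∷ []) #2
        ((λ ()) ∷ []) ((λ ()) ∷ (λ ()) ∷ [])

      backToStart : P.dec ⟦ 0 , a , 0 ∣ #0 ⟧ ≡ go 0 a → TwoColours
      backToStart moves with P.colouredChoice ⟦ 0 , a , 0 ∣ #1 ⟧ a≢0
      ... | stops halts = ⊥-elim (no-avoiding-trap (step₁ ◅ advance moves #1 refl refl ◅ ε)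
              (halted halts ∷ []) #2 ((λ ()) ∷ (λ ()) ∷ []) ((λ ()) ∷ []))
      ... | goes #0 _ back = ⊥-elim (shuttle moves back)
      ... | goes #2 _ back = ⊥-elim (shuttle moves back)

      leftBounce : P.dec ⟦ 0 , a , 0 ∣ #0 ⟧ ≡ go a a → P.dec ⟦ a , a , 0 ∣ #1 ⟧ ≡ go a a →
                   TwoColours
      leftBounce paint moves with P.colouredChoice ⟦ a , a , 0 ∣ #0 ⟧ a≢0
      ... | stops halts = ⊥-elim (no-avoiding-trap
              (step₁ ◅ advance paint #1 refl refl ◅ advance moves #0 refl refl ◅ ε)
              (halted halts ∷ []) #2 ((λ ()) ∷ (λ ()) ∷ (λ ()) ∷ []) ((λ ()) ∷ []))
      ... | goes #1 _ back = ⊥-elim (no-avoiding-trap (step₁ ◅ advance paint #1 refl refl ◅ ε)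
              (moved (there (here (advance moves #0 refl refl))) ∷
               moved (here (advance back #1 refl refl)) ∷ []) #2
              ((λ ()) ∷ (λ ()) ∷ []) ((λ ()) ∷ (λ ()) ∷ []))

      -- At vertex 2 the agent sees what it saw at vertex 0 after the first step, so paint recurs.
      allPainted : P.dec ⟦ 0 , a , 0 ∣ #0 ⟧ ≡ go a a → P.dec ⟦ a , a , 0 ∣ #1 ⟧ ≡ go a 0 →
                   blank #1 P.⟶* ⟦ a , a , a ∣ #1 ⟧
      allPainted paint turn =
        step₁ ◅ advance paint #1 refl refl ◅ advance turn #2 refl refl ◅ advance paint #1 refl refl ◅ ε

      fullLoop : P.dec ⟦ 0 , a , 0 ∣ #0 ⟧ ≡ go a a → P.dec ⟦ a , a , 0 ∣ #1 ⟧ ≡ go a 0 →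
                 P.dec ⟦ a , a , a ∣ #1 ⟧ ≡ go a a → TwoColours
      fullLoop paint turn moves with P.colouredChoice ⟦ a , a , a ∣ #0 ⟧ a≢0
      ... | stops halts = ⊥-elim (no-nonhalting-trap (allPainted paint turn)
              (moved (there (here (advance moves #0 refl refl))) ∷ halted halts ∷ [])
              ((λ _ → P.moving moves) ∷ (λ ()) ∷ []))
      ... | goes #1 _ back = ⊥-elim (no-nonhalting-trap (allPainted paint turn)
              (moved (there (here (advance moves #0 refl refl))) ∷
               moved (here (advance back #1 refl refl)) ∷ [])
              ((λ _ → P.moving moves) ∷ (λ _ → P.moving back) ∷ []))

      rightwards : P.dec ⟦ 0 , a , 0 ∣ #0 ⟧ ≡ go a a → TwoColours
      rightwards paint with P.colouredChoice ⟦ a , a , 0 ∣ #1 ⟧ a≢0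
      ... | stops halts = ⊥-elim (no-avoiding-trap (step₁ ◅ advance paint #1 refl refl ◅ ε)
              (halted halts ∷ []) #2 ((λ ()) ∷ (λ ()) ∷ []) ((λ ()) ∷ []))
      ... | goes #0 _ moves = leftBounce paint moves
      ... | goes #2 _ turn with P.colouredChoice ⟦ a , a , a ∣ #1 ⟧ a≢0
      ...   | stops done      = Triangle.afterFirstStep turn done
      ...   | goes #0 _ moves = fullLoop paint turn moves
      ...   | goes #2 _ moves = fullLoop paint turn moves

      afterFirstStep : TwoColours
      afterFirstStep with P.choice ⟦ 0 , a , 0 ∣ #0 ⟧
      ... | stops halts =
              ⊥-elim (no-avoiding-trap (step₁ ◅ ε) (halted halts ∷ []) #2 ((λ ()) ∷ []) ((λ ()) ∷ []))
      ... | goes c #1 _ moves with compare a c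
      ...   | none          = backToStart moves
      ...   | again         = rightwards moves
      ...   | other c≢0 c≢a =
                twoColours P₃ (step₁ ◅ advance moves #1 refl refl ◅ ε) a≢0 c≢0 c≢a (#1 , refl) (#0 , refl)

  firstMove : ∀ c → K.dec (blank #0) ≡ go c 0 → TwoColours
  firstMove c first with c ℕ.≟ 0
  ... | yes refl = ⊥-elim (K.Traps.no-nonhalting-trap (explores K₃) {p = #0} ε
          (moved (there (here (advance first #1 refl refl))) ∷ moved (here (advance first #0 refl refl)) ∷ [])
          ((λ _ → K.moving first) ∷ (λ ()) ∷ []))
  ... | no a≢0 = Path.afterFirstStep a≢0 first

  two-colours-needed : TwoColours
  two-colours-needed with K.choice (blank #0)
  ... | stops halts = ⊥-elim (K.Traps.no-avoiding-trap (explores K₃) {p = #0} ε (halted halts ∷ []) #1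
                                [] ((λ ()) ∷ []))
  ... | goes c #1 _ first = firstMove c first
  ... | goes c #2 _ first = firstMove c first

lemma8 : (k : ℕ) → (k ≡ 2 ⊎ k ≡ 3) → (A : Algorithm) →
         ((G : Graph k) → Explores A G) →
         Σ (Graph k) (λ G → UsesAtLeast A G (k ∸ 1))
lemma8 .2 (inj₁ refl) A explores = TwoVertices.one-colour-needed A explores
lemma8 .3 (inj₂ refl) A explores = ThreeVertices.two-colours-needed A explores
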